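{- Let $\mathbf V$ be a commutative unital quantale and let $\mathbf J=(T,r)$ be a $\mathbf V$-frame. Then: (1) For every $\mathbf V$-F-semilattice $\mathbf H=(\mathbf A,F)$ the map $\eta_{\mathbf H}\colon A\to (J\otimes H)^T$ defined by $(\eta_{\mathbf H}(x))(i)=\mathrm n(j[\mathbf J,\mathbf H])(x_{i=})$ ($x\in A$, $i\in T$) is a lax morphism of $\mathbf V$-F-semilattices $\mathbf H\to(\mathbf J\otimes\mathbf H)^{\mathbf J}$, and the family $\eta=(\eta_{\mathbf H})_{\mathbf H}$ is a natural transformation from the identity functor of $\mathbf V$-F-$\mathbb S_\le$ to the composite $(\mathbf J\otimes -)^{\mathbf J}$, i.e. $(\mathbf J\otimes f)^{\mathbf J}\circ\eta_{\mathbf H_1}=\eta_{\mathbf H_2}\circ f$ for every lax morphism $f\colon\mathbf H_1\to\mathbf H_2$. (2) For every $\mathbf V$-module $\mathbf L$ there is a unique $\mathbf V$-module homomorphism $\varepsilon_{\mathbf L}\colon \mathbf J\otimes\mathbf L^{\mathbf J}\to\mathbf L$ with $\varepsilon_{\mathbf L}\circ \mathrm n(j[\mathbf J,\mathbf L^{\mathbf J}])=e_{\mathbf L}$, where $e_{\mathbf L}\colon (L^T)^T\to L$ is given by $e_{\mathbf L}(\bar x)=\bigvee_{i\in T}(\bar x(i))(i)$; and $\varepsilon=(\varepsilon_{\mathbf L})_{\mathbf L}$ is a natural transformation from $\mathbf J\otimes(-)^{\mathbf J}$ to the identity functor of $\mathbf V$-$\mathbb S$, i.e. $\varepsilon_{\mathbf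 L_2}\circ(\mathbf J\otimes f^{\mathbf J})=f\circ\varepsilon_{\mathbf L_1}$ for every module homomorphism $f\colon\mathbf L_1\to\mathbf L_2$. (3) $(\eta,\varepsilon)$ is an adjoint situation $(\mathbf J\otimes -)\dashv(-)^{\mathbf J}$ between the functor $\mathbf J\otimes-\colon \mathbf V\text{ -F- }\mathbb S_\le\to\mathbf V\text{ - }\mathbb S$ and the functor $(-)^{\mathbf J}\colon\mathbf V\text{ - }\mathbb S\to\mathbf V\text{ -F- }\mathbb S_\le$; that is, $\varepsilon_{\mathbf J\otimes\mathbf H}\circ(\mathbf J\otimes\eta_{\mathbf H})=\mathrm{id}_{\mathbf J\otimes\mathbf H}$ and $(\varepsilon_{\mathbf L})^{\mathbf J}\circ\eta_{\mathbf L^{\mathbf J}}=\mathrm{id}_{\mathbf L^{\mathbf J}}$ for all $\mathbf H$ and $\mathbf L$.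
   Context: A commutative unital quantale $\mathbf V=(V,\bigvee,\otimes,e)$: $(V,\bigvee)$ is a complete lattice, $(V,\otimes,e)$ a commutative monoid, and $\otimes$ distributes over arbitrary joins. A $\mathbf V$-module $\mathbf A=(A,\bigvee,*)$ is a complete lattice $(A,\bigvee)$ with $*\colon V\times A\to A$ preserving arbitrary joins in each argument, $u*(v*a)=(u\otimes v)*a$, $e*a=a$. A module homomorphism preserves arbitrary joins and satisfies $f(v*a)=v*f(a)$; $\mathbf V$-$\mathbb S$ is the category of modules and module homomorphisms. A $\mathbf V$-frame is $\mathbf J=(T,r)$ with $T$ a set and $r\colon T\times T\to V$; a frame homomorphism $f\colon(T,r)\to(S,s)$ is a map with $r(i,j)\le s(f(i),f(j))$. A $\mathbf V$-F-semilattice is $\mathbf H=(\mathbf A,F)$ with $\mathbf A$ a module and $F\colon A\to A$ a module homomorphism; a lax morphism $f\colon(\mathbf A_1,F_1)\to(\mathbf A_2,F_2)$ is a module homomorphism with $F_2(f(a))\le f(F_1(a))$ for all $a$; $\mathbf V$-F-$\mathbb S_\le$ is the category of F-semilattices and lax morphisms. Powers: for a module $\mathbf L$ and frame $\mathbf J=(T,r)$, $\mathbf L^T$ is the module of maps $T\to L$ with pointwise joins and action, and $\mathbf L^{\mathbf J}=(\mathbf L^T,F^{\mathbf J})$ with $(F^{\mathbf J}(x))(i)=\bigvee_{k\in T}r(i,k)*x(k)$. For a module homomorphism $f\colon\mathbf L_1\to\mathbf L_2$, $f^{\mathbf J}\colon L_1^T\to L_2^T$ is $(f^{\mathbf J}(x))(i)=f(x(i))$.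 Prenuclei: for an F-semilattice $(\mathbf M,G)$, a prenucleus is $j\colon M\to M$ with $a\le j(a)$, $a\le b\Rightarrow j(a)\le j(b)$, $v*j(a)\le j(v*a)$, $G(j(a))\le j(G(a))$. $M_j=\{a\mid j(a)=a\}$, and $\mathrm n(j)(a)=\bigwedge\{x\in M_j\mid a\le x\}$. For a nucleus (idempotent prenucleus) $k$, $M_k$ is a module with joins $k(\bigvee S)$ and action $v*_{M_k}m=k(v*m)$. For $X\subseteq M\times M$, $j[X](a)=a\vee\bigvee\{c\in M\mid \exists d\le a:\ (c,d)\in X\text{ or }(d,c)\in X\}$. Tensor: for a frame $\mathbf J=(T,r)$, F-semilattice $\mathbf H=(\mathbf A,F)$, $x\in A$, $i\in T$, let $x_{ir}\in A^T$, $x_{ir}(j)=r(i,j)*x$, and $x_{i=}\in A^T$, $x_{i=}(i)=x$, $x_{i=}(j)=0$ for $j\ne i$. Let $[\mathbf J,\mathbf H]=\{(x_{ir}\vee F(x)_{i=},F(x)_{i=})\mid x\in A,i\in T\}\subseteq A^T\times A^T$, $j[\mathbf J,\mathbf H]=j[[\mathbf J,\mathbf H]]$ computed in the module $\mathbf A^T$ (regarded as F-semilattice with identity operator), and $\mathbf J\otimes\mathbf H=(\mathbf A^T)_{\mathrm n(j[\mathbf J,\mathbf H])}$; $\mathrm n(j[\mathbf J,\mathbf H])$ is regarded as a surjective module homomorphism $A^T\to \mathbf J\otimes\mathbf H$. For a lax morphism $f\colon\mathbf H_1\to\mathbf H_2$, $\mathbf J\otimes f\colon\mathbf J\otimes\mathbf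 H_1\to\mathbf J\otimes\mathbf H_2$ is the unique module homomorphism with $\mathrm n(j[\mathbf J,\mathbf H_2])\circ f^{\mathbf J}=(\mathbf J\otimes f)\circ\mathrm n(j[\mathbf J,\mathbf H_1])$ (where $f^{\mathbf J}(x)(i)=f(x(i))$ on $A_1^T$). -}

module Defs where

open import Level using (Level; Lift; lift) renaming (suc to lsuc)
open import Data.Product using (Σ; _×_; _,_; proj₁; proj₂)
open import Data.Sum using (_⊎_; inj₁; inj₂)
open import Data.Bool using (Bool; true; false)
open import Data.Empty using (⊥)
open import Relation.Binary.PropositionalEquality using (_≡_)

record CLat (ℓ : Level) : Set (lsuc ℓ) where
  infix 4 _≤_ _≈_
  field
    Car : Set ℓ
    _≤_ : Car → Car → Set ℓ
    ⋁   : {I : Set ℓ} → (I → Car) → Car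

  _≈_ : Car → Car → Set ℓ
  a ≈ b = (a ≤ b) × (b ≤ a)

  _∨_ : Car → Car → Car
  a ∨ b = ⋁ {Lift ℓ Bool} λ { (lift true) → a ; (lift false) → b }

  bot : Car
  bot = ⋁ {Lift ℓ ⊥} λ { (lift ()) }

  ⋀ : (Car → Set ℓ) → Car
  ⋀ P = ⋁ {Σ Car (λ y → ∀ x → P x → y ≤ x)} proj₁

record IsCLat {ℓ : Level} (L : CLat ℓ) : Set (lsuc ℓ) where
  open CLat L
  field
    ≤-refl  : ∀ {a} → a ≤ a
    ≤-trans : ∀ {a b c} → a ≤ b → b ≤ c → a ≤ c
    ⋁-ub    : ∀ {I : Set ℓ} (f : I → Car) (i : I) → f i ≤ ⋁ f
    ⋁-least : ∀ {I : Set ℓ} (f : I → Car) (a : Car) → (∀ i → f i ≤ a) → ⋁ f ≤ a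

record Quantale (ℓ : Level) : Set (lsuc ℓ) where
  field
    lat    : CLat ℓ
    isCLat : IsCLat lat
  open CLat lat public
  infixl 7 _⊗_
  field
    _⊗_ : Car → Car → Car
    e   : Car
    ⊗-cong      : ∀ {u u' v v'} → u ≈ u' → v ≈ v' → (u ⊗ v) ≈ (u' ⊗ v')
    ⊗-assoc     : ∀ u v w → ((u ⊗ v) ⊗ w) ≈ (u ⊗ (v ⊗ w))
    ⊗-comm      : ∀ u v → (u ⊗ v) ≈ (v ⊗ u)
    ⊗-identityˡ : ∀ u → (e ⊗ u) ≈ u
    -- (right identity / right distributivity follow by commutativity)
    ⊗-distrib-⋁ : ∀ u {I : Set ℓ} (f : I → Car) → (u ⊗ ⋁ f) ≈ ⋁ (λ i → u ⊗ f i)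

-- Lattices with an action of V (lattice laws only; no module laws).
-- Used for raw constructions such as powers and tensors.

record RMod {ℓ : Level} (V : Quantale ℓ) : Set (lsuc ℓ) where
  field
    lat    : CLat ℓ
    isCLat : IsCLat lat
  open CLat lat public
  open IsCLat isCLat public
  infixr 7 _*_
  field
    _*_ : Quantale.Car V → Car → Car

record IsModule {ℓ : Level} {V : Quantale ℓ} (M : RMod V) : Set (lsuc ℓ) where
  private module V = Quantale V
  open RMod M
  field
    *-cong     : ∀ {u v a b} → u V.≈ v → a ≈ b → (u * a) ≈ (v * b)
    *-⋁ʳ       : ∀ u {I : Set ℓ} (f : I → Car) → (u * ⋁ f) ≈ ⋁ (λ i → u * f i)
    *-⋁ˡ       : ∀ {I : Set ℓ} (g : I → V.Car) a → (V.⋁ g * a) ≈ ⋁ (λ i → g i * a)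
    *-assoc    : ∀ u v a → (u * (v * a)) ≈ ((u V.⊗ v) * a)
    *-identity : ∀ a → (V.e * a) ≈ a

record Module {ℓ : Level} (V : Quantale ℓ) : Set (lsuc ℓ) where
  field
    raw      : RMod V
    isModule : IsModule raw
  open RMod raw public

-- module homomorphisms (respecting ≈, as functions on the quotient)
record IsModuleHom {ℓ : Level} {V : Quantale ℓ} (M N : RMod V)
                   (f : RMod.Car M → RMod.Car N) : Set (lsuc ℓ) where
  private
    module M = RMod M
    module N = RMod N
  field
    resp   : ∀ {a b} → a M.≈ b → f a N.≈ f b
    pres-⋁ : ∀ {I : Set ℓ} (g : I → M.Car) → f (M.⋁ g) N.≈ N.⋁ (λ i → f (g i))
    pres-* : ∀ v a → f (v M.* a) N.≈ (v N.* f a)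

record RFSL {ℓ : Level} (V : Quantale ℓ) : Set (lsuc ℓ) where
  field
    mod : RMod V
    F   : RMod.Car mod → RMod.Car mod
  open RMod mod public

record FSemilattice {ℓ : Level} (V : Quantale ℓ) : Set (lsuc ℓ) where
  field
    mod      : RMod V
    isModule : IsModule mod
    F        : RMod.Car mod → RMod.Car mod
    F-hom    : IsModuleHom mod mod F
  toRFSL : RFSL V
  toRFSL = record { mod = mod ; F = F }
  open RMod mod public

record IsLax {ℓ : Level} {V : Quantale ℓ} (H₁ H₂ : RFSL V)
             (f : RFSL.Car H₁ → RFSL.Car H₂) : Set (lsuc ℓ) where
  private
    module H₁ = RFSL H₁
    module H₂ = RFSL H₂
  field
    hom : IsModuleHom H₁.mod H₂.mod f
    lax : ∀ a → H₂.F (f a) H₂.≤ f (H₁.F a)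

record Frame {ℓ : Level} (V : Quantale ℓ) : Set (lsuc ℓ) where
  field
    T : Set ℓ
    r : T → T → Quantale.Car V

module LatOps {ℓ : Level} (L : CLat ℓ) where
  open CLat L

  nuc : (Car → Car) → Car → Car
  nuc j a = ⋀ (λ x → (j x ≈ x) × (a ≤ x))

  -- j[X] for X ⊆ Car × Car given as a family p : K → Car × Car
  jRel : {K : Set ℓ} → (K → Car × Car) → Car → Car
  jRel {K} p a = a ∨ ⋁ {(Σ K (λ κ → proj₂ (p κ) ≤ a)) ⊎ (Σ K (λ κ → proj₁ (p κ) ≤ a))}
                       (λ { (inj₁ (κ , _)) → proj₁ (p κ) ; (inj₂ (κ , _)) → proj₂ (p κ) })

module NucLemmas {ℓ : Level} (L : CLat ℓ) (isL : IsCLat L) where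
  open CLat L
  open IsCLat isL
  open LatOps L

  meet-lb : ∀ (P : Car → Set ℓ) x → P x → ⋀ P ≤ x
  meet-lb P x px = ⋁-least proj₁ x (λ yh → proj₂ yh x px)

  meet-glb : ∀ (P : Car → Set ℓ) a → (∀ x → P x → a ≤ x) → a ≤ ⋀ P
  meet-glb P a h = ⋁-ub {Σ Car (λ y → ∀ x → P x → y ≤ x)} proj₁ (a , h)

  meet-anti : ∀ (P Q : Car → Set ℓ) → (∀ x → P x → Q x) → ⋀ Q ≤ ⋀ P
  meet-anti P Q pq = meet-glb P (⋀ Q) (λ x px → meet-lb Q x (pq x px))

  module _ (j : Car → Car) where
    nuc-ext : ∀ a → a ≤ nuc j a
    nuc-ext a = meet-glb _ a (λ x s → proj₂ s)

    nuc-mono : ∀ {a b} → a ≤ b → nuc j a ≤ nuc j b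
    nuc-mono a≤b = meet-anti _ _ (λ x s → proj₁ s , ≤-trans a≤b (proj₂ s))

    nuc-idem : ∀ a → nuc j (nuc j a) ≈ nuc j a
    nuc-idem a =
      meet-anti _ _ (λ x s → proj₁ s , meet-lb _ x s) ,
      meet-anti _ _ (λ x s → proj₁ s , ≤-trans (nuc-ext a) (proj₂ s))

powMap : {ℓ : Level} {T A B : Set ℓ} → (A → B) → (T → A) → (T → B)
powMap f x i = f (x i)

module _ {ℓ : Level} {V : Quantale ℓ} where

  powLat : (T : Set ℓ) → CLat ℓ → CLat ℓ
  powLat T L = record
    { Car = T → L.Car
    ; _≤_ = λ x y → ∀ i → x i L.≤ y i
    ; ⋁   = λ g i → L.⋁ (λ k → g k i)
    }
    where module L = CLat L

  powIs : (T : Set ℓ) (L : CLat ℓ) → IsCLat L → IsCLat (powLat T L)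
  powIs T L isL = record
    { ≤-refl  = λ i → ≤-refl
    ; ≤-trans = λ p q i → ≤-trans (p i) (q i)
    ; ⋁-ub    = λ f i t → ⋁-ub (λ k → f k t) i
    ; ⋁-least = λ f a h t → ⋁-least (λ k → f k t) (a t) (λ i → h i t)
    }
    where open IsCLat isL

  Pow : (T : Set ℓ) → RMod V → RMod V
  Pow T M = record
    { lat    = powLat T M.lat
    ; isCLat = powIs T M.lat M.isCLat
    ; _*_    = λ v x i → v M.* x i
    }
    where module M = RMod M

  module _ (M : RMod V) (k : RMod.Car M → RMod.Car M)
           (ext  : ∀ a → RMod._≤_ M a (k a))
           (mono : ∀ {a b} → RMod._≤_ M a b → RMod._≤_ M (k a) (k b))
           (idem : ∀ a → RMod._≈_ M (k (k a)) (k a)) where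
    private module M = RMod M

    fixLat : CLat ℓ
    fixLat = record
      { Car = Σ M.Car (λ a → k a M.≈ a)
      ; _≤_ = λ m m' → proj₁ m M.≤ proj₁ m'
      ; ⋁   = λ g → k (M.⋁ (λ i → proj₁ (g i))) , idem _
      }

    fixIs : IsCLat fixLat
    fixIs = record
      { ≤-refl  = M.≤-refl
      ; ≤-trans = M.≤-trans
      ; ⋁-ub    = λ g i → M.≤-trans (M.⋁-ub (λ i → proj₁ (g i)) i) (ext _)
      ; ⋁-least = λ g a h → M.≤-trans (mono (M.⋁-least (λ i → proj₁ (g i)) (proj₁ a) h))
                                      (proj₁ (proj₂ a))
      }

    Fix : RMod V
    Fix = record
      { lat    = fixLat
      ; isCLat = fixIs
      ; _*_    = λ v m → k (v M.* proj₁ m) , idem _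
      }

module Tensor {ℓ : Level} {V : Quantale ℓ} (J : Frame V) where
  open Frame J

  powF : RMod V → RFSL V
  powF L = record
    { mod = Pow T L
    ; F   = λ x i → L.⋁ (λ k → r i k L.* x k)
    }
    where module L = RMod L

  module _ (H : RFSL V) where
    private
      module H = RFSL H
      PA : RMod V
      PA = Pow T H.mod
      module PA = RMod PA

    -- x_{i=} : x at i, 0 elsewhere (join over the proposition i ≡ k)
    x_i= : H.Car → T → PA.Car
    x_i= x i k = H.⋁ {i ≡ k} (λ _ → x)

    x_ir : H.Car → T → PA.Car
    x_ir x i k = r i k H.* x

    -- the relation [J,H], as the family indexed by (x , i)
    gen : H.Car × T → PA.Car × PA.Car
    gen (x , i) = (x_ir x i PA.∨ x_i= (H.F x) i) , x_i= (H.F x) i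

    jJH : PA.Car → PA.Car
    jJH = LatOps.jRel PA.lat gen

    nJH : PA.Car → PA.Car
    nJH = LatOps.nuc PA.lat jJH

    private module NL = NucLemmas PA.lat PA.isCLat

    tensor : RMod V
    tensor = Fix PA nJH (NL.nuc-ext jJH) (NL.nuc-mono jJH) (NL.nuc-idem jJH)

    -- n(j[J,H]) regarded as a surjection A^T → J ⊗ H
    q : PA.Car → RMod.Car tensor
    q a = nJH a , NL.nuc-idem jJH a

    η : H.Car → T → RMod.Car tensor
    η x i = q (x_i= x i)

  -- J ⊗ f : J ⊗ H₁ → J ⊗ H₂, the unique map with
  -- n(j[J,H₂]) ∘ f^J = (J ⊗ f) ∘ n(j[J,H₁]); on a fixed point m it is n₂(f^J(m))
  tensorMap : (H₁ H₂ : RFSL V) → (RFSL.Car H₁ → RFSL.Car H₂)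
            → RMod.Car (tensor H₁) → RMod.Car (tensor H₂)
  tensorMap H₁ H₂ f m = q H₂ (powMap f (proj₁ m))

  eMap : (L : RMod V) → (T → T → RMod.Car L) → RMod.Car L
  eMap L xx = RMod.⋁ L (λ i → xx i i)

  ε : (L : RMod V) → RMod.Car (tensor (powF L)) → RMod.Car L
  ε L m = eMap L (proj₁ m)

-- The fixed points of n(j[J,H]) are exactly the saturated families m ∈ A^T: F(x)_{i=} ≤ m
-- implies x_{ir} ≤ m.  If f : H₁ → H₂ is lax, its pointwise right adjoint carries saturated
-- families to saturated ones, hence n₂ ∘ f^J ∘ n₁ = n₂ ∘ f^J; this gives the naturality of η,
-- and, applied to the maps v * _ and r(i,k) * _, the compatibility of η with the action and
-- with F.  For a power L^J the family that is below l on the diagonal and ⊤ off it is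
-- saturated, so e_L ∘ n = e_L, and ε inherits all its properties from e_L.
module Submission where

open import Defs
open import Data.Product using (Σ; _×_; _,_; proj₁; proj₂; swap)
open import Level using (Level; lift) renaming (suc to lsuc)
open import Data.Sum using (inj₁; inj₂)
open import Data.Bool using (true; false)
open import Function using (_∘_)
open import Relation.Binary.PropositionalEquality using (_≡_; refl; subst)

module CLatProperties {ℓ : Level} (L : CLat ℓ) (isL : IsCLat L) where
  open CLat L
  open IsCLat isL

  ≈-trans : ∀ {a b c} → a ≈ b → b ≈ c → a ≈ c
  ≈-trans (p , p') (q , q') = ≤-trans p q , ≤-trans q' p'

  ∨-upperˡ : ∀ a b → a ≤ a ∨ b
  ∨-upperˡ a b = ⋁-ub _ (lift true)

  ∨-upperʳ : ∀ a b → b ≤ a ∨ b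
  ∨-upperʳ a b = ⋁-ub _ (lift false)

  ∨-least : ∀ {a b c} → a ≤ c → b ≤ c → a ∨ b ≤ c
  ∨-least a≤c b≤c = ⋁-least _ _ λ { (lift true) → a≤c ; (lift false) → b≤c }

  ⋁-mono : ∀ {I : Set ℓ} {f g : I → Car} → (∀ i → f i ≤ g i) → ⋁ f ≤ ⋁ g
  ⋁-mono {g = g} f≤g = ⋁-least _ _ λ i → ≤-trans (f≤g i) (⋁-ub g i)

  ⋁-swap : ∀ {I K : Set ℓ} (f : I → K → Car) →
           ⋁ (λ i → ⋁ (λ k → f i k)) ≤ ⋁ (λ k → ⋁ (λ i → f i k))
  ⋁-swap f = ⋁-least _ _ λ i → ⋁-least _ _ λ k →
    ≤-trans (⋁-ub (λ i → f i k) i) (⋁-ub (λ k → ⋁ (λ i → f i k)) k)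

  ⋁-comm : ∀ {I K : Set ℓ} (f : I → K → Car) →
           ⋁ (λ i → ⋁ (λ k → f i k)) ≈ ⋁ (λ k → ⋁ (λ i → f i k))
  ⋁-comm f = ⋁-swap f , ⋁-swap (λ k i → f i k)

-- f a ≤ ⋁ {f y ∣ y ≤ b} ≤ f (⋁ {y ∣ y ≤ b}) ≈ f b
module _ {ℓ : Level} (L₁ L₂ : CLat ℓ) (isL₁ : IsCLat L₁) (isL₂ : IsCLat L₂) where
  private
    module L₁ = CLat L₁
    module L₂ = CLat L₂
    open IsCLat

  ⋁-superadditive⇒mono : (f : L₁.Car → L₂.Car) →
    (∀ {a b} → a L₁.≈ b → f a L₂.≤ f b) →
    (∀ {I : Set ℓ} (g : I → L₁.Car) → L₂.⋁ (f ∘ g) L₂.≤ f (L₁.⋁ g)) →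
    ∀ {a b} → a L₁.≤ b → f a L₂.≤ f b
  ⋁-superadditive⇒mono f resp sup {a} {b} a≤b =
    ≤-trans isL₂ (⋁-ub isL₂ (f ∘ proj₁) (a , a≤b))
      (≤-trans isL₂ (sup {Σ L₁.Car (L₁._≤ b)} proj₁)
        (resp (⋁-least isL₁ proj₁ b proj₂ , ⋁-ub isL₁ proj₁ (b , ≤-refl isL₁))))

module _ {ℓ : Level} {V : Quantale ℓ} where

  hom⇒mono : ∀ {M N : RMod V} {f : RMod.Car M → RMod.Car N} → IsModuleHom M N f →
             ∀ {a b} → RMod._≤_ M a b → RMod._≤_ N (f a) (f b)
  hom⇒mono {M} {N} {f} hom = ⋁-superadditive⇒mono (RMod.lat M) (RMod.lat N)
    (RMod.isCLat M) (RMod.isCLat N) f (proj₁ ∘ resp) (proj₂ ∘ pres-⋁)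
    where open IsModuleHom hom

module JRelClosure {ℓ : Level} (L : CLat ℓ) (isL : IsCLat L)
                   {K : Set ℓ} (p : K → CLat.Car L × CLat.Car L) where
  open CLat L
  open IsCLat isL
  open LatOps L
  open NucLemmas L isL
  open CLatProperties L isL

  Closed : Car → Set ℓ
  Closed m = ∀ κ → (proj₂ (p κ) ≤ m → proj₁ (p κ) ≤ m) × (proj₁ (p κ) ≤ m → proj₂ (p κ) ≤ m)

  closed⇒fixed : ∀ {m} → Closed m → jRel p m ≈ m
  closed⇒fixed {m} closed =
    ∨-least ≤-refl (⋁-least _ _ λ
      { (inj₁ (κ , d≤m)) → proj₁ (closed κ) d≤m
      ; (inj₂ (κ , c≤m)) → proj₂ (closed κ) c≤m }) ,
    ∨-upperˡ _ _

  nuc-least : ∀ {a m} → Closed m → a ≤ m → nuc (jRel p) a ≤ m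
  nuc-least {m = m} closed a≤m = meet-lb _ m (closed⇒fixed closed , a≤m)

  jRel-pair₁ : ∀ {x} κ → proj₂ (p κ) ≤ x → proj₁ (p κ) ≤ jRel p x
  jRel-pair₁ {x} κ d≤x = ≤-trans (⋁-ub _ (inj₁ (κ , d≤x))) (∨-upperʳ x _)

  jRel-pair₂ : ∀ {x} κ → proj₁ (p κ) ≤ x → proj₂ (p κ) ≤ jRel p x
  jRel-pair₂ {x} κ c≤x = ≤-trans (⋁-ub _ (inj₂ (κ , c≤x))) (∨-upperʳ x _)

  nuc-closed : ∀ a → Closed (nuc (jRel p) a)
  nuc-closed a κ =
    (λ d≤n → meet-glb _ _ λ x fx →
       ≤-trans (jRel-pair₁ κ (≤-trans d≤n (meet-lb _ x fx))) (proj₁ (proj₁ fx))) ,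
    (λ c≤n → meet-glb _ _ λ x fx →
       ≤-trans (jRel-pair₂ κ (≤-trans c≤n (meet-lb _ x fx))) (proj₁ (proj₁ fx)))

  fixed⇒closed : ∀ {m} → nuc (jRel p) m ≈ m → Closed m
  fixed⇒closed {m} (n≤m , _) κ =
    (λ d≤m → ≤-trans (proj₁ (nuc-closed m κ) (≤-trans d≤m (nuc-ext _ m))) n≤m) ,
    (λ c≤m → ≤-trans (proj₂ (nuc-closed m κ) (≤-trans c≤m (nuc-ext _ m))) n≤m)

module _ {ℓ : Level} {V : Quantale ℓ} (M : RMod V) (k : RMod.Car M → RMod.Car M)
         (ext  : ∀ a → RMod._≤_ M a (k a))
         (mono : ∀ {a b} → RMod._≤_ M a b → RMod._≤_ M (k a) (k b))
         (idem : ∀ a → RMod._≈_ M (k (k a)) (k a)) where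

  Fix-induced-hom : (N : RMod V) (h : RMod.Car M → RMod.Car N) → IsModuleHom M N h →
                    (∀ a → RMod._≈_ N (h (k a)) (h a)) →
                    IsModuleHom (Fix M k ext mono idem) N (h ∘ proj₁)
  Fix-induced-hom N h h-hom h-k = record
    { resp   = resp
    ; pres-⋁ = λ g → ≈-trans (h-k _) (pres-⋁ (proj₁ ∘ g))
    ; pres-* = λ v m → ≈-trans (h-k _) (pres-* v (proj₁ m))
    }
    where
      open IsModuleHom h-hom
      open CLatProperties (RMod.lat N) (RMod.isCLat N)

module Adjunction {ℓ : Level} {V : Quantale ℓ} (J : Frame V) where
  open Frame J
  open Tensor J

  module Saturation (H : RFSL V) where
    private
      module H = RFSL H
    HT : RMod V
    HT = Pow T H.mod
    module HT where
      open RMod HT public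
      open CLatProperties lat isCLat public

    x_i=-least : ∀ {x i} (m : HT.Car) → x H.≤ m i → x_i= H x i HT.≤ m
    x_i=-least {x} {i} m x≤mi k = H.⋁-least _ (m k) λ i≡k → subst (λ k → x H.≤ m k) i≡k x≤mi

    x_i=-diag : ∀ {x i} → x H.≤ x_i= H x i i
    x_i=-diag = H.⋁-ub _ refl

    x_i=-≤⇒ : ∀ {x i} (m : HT.Car) → x_i= H x i HT.≤ m → x H.≤ m i
    x_i=-≤⇒ m x_i=≤m = H.≤-trans x_i=-diag (x_i=≤m _)

    x_i=-mono : ∀ {x y i} → x H.≤ y → x_i= H x i HT.≤ x_i= H y i
    x_i=-mono x≤y = x_i=-least _ (H.≤-trans x≤y x_i=-diag)

    ≤-⋁-x_i= : ∀ a → a HT.≤ HT.⋁ (λ i → x_i= H (a i) i)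
    ≤-⋁-x_i= a k = H.≤-trans x_i=-diag (H.⋁-ub (λ i → x_i= H (a i) i k) k)

    Saturated : HT.Car → Set ℓ
    Saturated m = ∀ x i → x_i= H (H.F x) i HT.≤ m → x_ir H x i HT.≤ m

    private
      module C = JRelClosure HT.lat HT.isCLat (gen H)
      module NL = NucLemmas HT.lat HT.isCLat

    -- Each pair of [J,H] has its second component below its first, so only one direction matters.
    saturated⇒closed : ∀ {m} → Saturated m → C.Closed m
    saturated⇒closed sat (x , i) =
      (λ d≤m → HT.∨-least (sat x i d≤m) d≤m) ,
      (λ c≤m → HT.≤-trans (HT.∨-upperʳ (x_ir H x i) _) c≤m)

    closed⇒saturated : ∀ {m} → C.Closed m → Saturated m
    closed⇒saturated closed x i d≤m =
      HT.≤-trans (HT.∨-upperˡ _ (x_i= H (H.F x) i)) (proj₁ (closed (x , i)) d≤m)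

    nuc-ext : ∀ a → a HT.≤ nJH H a
    nuc-ext = NL.nuc-ext (jJH H)

    nuc-mono : ∀ {a b} → a HT.≤ b → nJH H a HT.≤ nJH H b
    nuc-mono = NL.nuc-mono (jJH H)

    nuc-least : ∀ {a m} → Saturated m → a HT.≤ m → nJH H a HT.≤ m
    nuc-least sat = C.nuc-least (saturated⇒closed sat)

    nuc-saturated : ∀ a → Saturated (nJH H a)
    nuc-saturated a = closed⇒saturated (C.nuc-closed a)

    fixed⇒saturated : ∀ {m} → nJH H m HT.≈ m → Saturated m
    fixed⇒saturated fixed = closed⇒saturated (C.fixed⇒closed fixed)

    ≈-q-proj₁ : ∀ m → RMod._≈_ (tensor H) m (q H (proj₁ m))
    ≈-q-proj₁ m = nuc-ext (proj₁ m) , proj₁ (proj₂ m)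

  -- The inequational half of a lax morphism; the maps v * _ of a module are of this kind too.
  record IsSubLax (H₁ H₂ : RFSL V) (f : RFSL.Car H₁ → RFSL.Car H₂) : Set (lsuc ℓ) where
    private
      module H₁ = RFSL H₁
      module H₂ = RFSL H₂
    field
      mono  : ∀ {a b} → a H₁.≤ b → f a H₂.≤ f b
      ⋁-sub : ∀ {I : Set ℓ} (g : I → H₁.Car) → f (H₁.⋁ g) H₂.≤ H₂.⋁ (f ∘ g)
      *-sub : ∀ v a → f (v H₁.* a) H₂.≤ v H₂.* f a
      F-lax : ∀ a → H₂.F (f a) H₂.≤ f (H₁.F a)

  module Transport {H₁ H₂ : RFSL V} {f : RFSL.Car H₁ → RFSL.Car H₂} (sub : IsSubLax H₁ H₂ f) where
    private
      module H₁ = RFSL H₁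
      module H₂ = RFSL H₂
      module S₁ = Saturation H₁
      module S₂ = Saturation H₂
    open IsSubLax sub

    res : S₂.HT.Car → S₁.HT.Car
    res m k = H₁.⋁ {Σ H₁.Car (λ a → f a H₂.≤ m k)} proj₁

    res-counit : ∀ m k {a} → a H₁.≤ res m k → f a H₂.≤ m k
    res-counit m k a≤res =
      H₂.≤-trans (mono a≤res) (H₂.≤-trans (⋁-sub proj₁) (H₂.⋁-least _ (m k) proj₂))

    res-unit : ∀ m k {a} → f a H₂.≤ m k → a H₁.≤ res m k
    res-unit m k {a} fa≤m = H₁.⋁-ub proj₁ (a , fa≤m)

    res-saturated : ∀ {m} → S₂.Saturated m → S₁.Saturated (res m)
    res-saturated {m} sat y i Fy≤res k =
      res-unit m k (H₂.≤-trans (*-sub (r i k) y) (sat (f y) i Ffy≤m k))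
      where
        Ffy≤m : x_i= H₂ (H₂.F (f y)) i S₂.HT.≤ m
        Ffy≤m = S₂.x_i=-least m (H₂.≤-trans (F-lax y) (res-counit m i (S₁.x_i=-≤⇒ _ Fy≤res)))

    powMap-nuc-≤ : ∀ {m b} → S₂.Saturated m → powMap f b S₂.HT.≤ m → powMap f (nJH H₁ b) S₂.HT.≤ m
    powMap-nuc-≤ {m} sat fb≤m k =
      res-counit m k (S₁.nuc-least (res-saturated sat) (λ t → res-unit m t (fb≤m t)) k)

    powMap-x_i= : ∀ {x i} → powMap f (x_i= H₁ x i) S₂.HT.≤ x_i= H₂ (f x) i
    powMap-x_i= k = ⋁-sub _

    tensorMap-η : ∀ x i → RMod._≈_ (tensor H₂) (tensorMap H₁ H₂ f (η H₁ x i)) (η H₂ (f x) i)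
    tensorMap-η x i =
      S₂.nuc-least (S₂.nuc-saturated _)
        (powMap-nuc-≤ (S₂.nuc-saturated _) (S₂.HT.≤-trans powMap-x_i= (S₂.nuc-ext _))) ,
      S₂.nuc-mono (S₂.x_i=-least _ (mono (H₁.≤-trans S₁.x_i=-diag (S₁.nuc-ext _ i))))

  lax⇒subLax : ∀ {H₁ H₂ : RFSL V} {f : RFSL.Car H₁ → RFSL.Car H₂} → IsLax H₁ H₂ f → IsSubLax H₁ H₂ f
  lax⇒subLax record { hom = hom ; lax = lax } = record
    { mono  = hom⇒mono hom
    ; ⋁-sub = proj₁ ∘ pres-⋁
    ; *-sub = λ v a → proj₁ (pres-* v a)
    ; F-lax = lax
    }
    where open IsModuleHom hom

  action-subLax : (H : FSemilattice V) (v : Quantale.Car V) →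
                  IsSubLax (FSemilattice.toRFSL H) (FSemilattice.toRFSL H) (FSemilattice._*_ H v)
  action-subLax H v = record
    { mono  = ⋁-superadditive⇒mono lat lat isCLat isCLat (v *_)
                (λ a≈b → proj₁ (*-cong (V.≤-refl , V.≤-refl) a≈b)) (proj₂ ∘ *-⋁ʳ v)
    ; ⋁-sub = proj₁ ∘ *-⋁ʳ v
    ; *-sub = λ u a → ≤-trans (proj₁ (*-assoc v u a))
                        (≤-trans (proj₁ (*-cong (V.⊗-comm v u) (≤-refl , ≤-refl)))
                                 (proj₂ (*-assoc u v a)))
    ; F-lax = λ a → proj₁ (IsModuleHom.pres-* F-hom v a)
    }
    where
      open FSemilattice H
      open IsModule isModule
      module V where
        open Quantale V public using (⊗-comm)
        open IsCLat (Quantale.isCLat V) public using (≤-refl)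

  module Unit (H : FSemilattice V) where
    private
      H' : RFSL V
      H' = FSemilattice.toRFSL H
      module H where
        open RFSL H' public
        open CLatProperties lat isCLat public
    open Saturation H'

    η-mono : ∀ {x y} → x H.≤ y → ∀ i → RMod._≤_ (tensor H') (η H' x i) (η H' y i)
    η-mono x≤y i = nuc-mono (x_i=-mono x≤y)

    η-isLax : IsLax H' (powF (tensor H')) (η H')
    η-isLax = record
      { hom = record
        { resp   = λ (x≤y , y≤x) → η-mono x≤y , η-mono y≤x
        ; pres-⋁ = λ g →
            (λ i → nuc-mono (x_i=-least _ (H.⋁-mono λ k → H.≤-trans x_i=-diag (nuc-ext _ i)))) ,
            (λ i → nuc-least (nuc-saturated _) (HT.⋁-least _ _ λ k → η-mono (H.⋁-ub g k) i))
        -- v * η x is J ⊗ (v * _) applied pointwise to η x.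
        ; pres-* = λ v x →
            (λ i → proj₂ (Transport.tensorMap-η (action-subLax H v) x i)) ,
            (λ i → proj₁ (Transport.tensorMap-η (action-subLax H v) x i))
        }
      -- F^J (η x) i is the join of the (J ⊗ (r i k * _)) (η x k).
      ; lax = λ x i → nuc-least (nuc-saturated _) (HT.⋁-least _ _ λ k →
          HT.≤-trans (proj₁ (Transport.tensorMap-η (action-subLax H (r i k)) x k))
                     (nuc-least (nuc-saturated _)
                       (x_i=-least _ (nuc-saturated _ x i (nuc-ext _) k))))
      }

  η-natural : (H₁ H₂ : RFSL V) (f : RFSL.Car H₁ → RFSL.Car H₂) → IsLax H₁ H₂ f →
              ∀ x → RMod._≈_ (Pow T (tensor H₂)) (powMap (tensorMap H₁ H₂ f) (η H₁ x)) (η H₂ (f x))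
  η-natural H₁ H₂ f lax x = (λ i → proj₁ (tensorMap-η x i)) , (λ i → proj₂ (tensorMap-η x i))
    where open Transport (lax⇒subLax lax)

  module Counit (L : RMod V) where
    private
      module L where
        open RMod L public
        open CLatProperties lat isCLat public
    open Saturation (powF L)

    -- The largest family whose diagonal entries are all below l.
    diagBound : L.Car → HT.Car
    diagBound l i j = L.⋁ {Σ L.Car (λ y → i ≡ j → y L.≤ l)} proj₁

    diagBound-diag : ∀ l i → diagBound l i i L.≤ l
    diagBound-diag l i = L.⋁-least proj₁ l λ (y , y≤l) → y≤l refl

    diagBound-saturated : ∀ l → Saturated (diagBound l)
    diagBound-saturated l x i Fx≤bound k j = L.⋁-ub proj₁ (r i k L.* x j , λ { refl →
      L.≤-trans (L.⋁-ub (λ k → r i k L.* x k) k)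
                (L.≤-trans (x_i=-≤⇒ (diagBound l) Fx≤bound i) (diagBound-diag l i)) })

    ≤-diagBound-eMap : ∀ xx → xx HT.≤ diagBound (eMap L xx)
    ≤-diagBound-eMap xx i j = L.⋁-ub proj₁ (xx i j , λ { refl → L.⋁-ub (λ i → xx i i) i })

    eMap-mono : ∀ {xx yy} → xx HT.≤ yy → eMap L xx L.≤ eMap L yy
    eMap-mono xx≤yy = L.⋁-mono λ i → xx≤yy i i

    eMap-nuc : ∀ xx → eMap L (nJH (powF L) xx) L.≈ eMap L xx
    eMap-nuc xx =
      L.⋁-least _ _ (λ i → L.≤-trans (nuc-least (diagBound-saturated _) (≤-diagBound-eMap xx) i i)
                                     (diagBound-diag _ i)) ,
      eMap-mono (nuc-ext xx)

    eMap-x_i= : ∀ x i → eMap L (x_i= (powF L) x i) L.≈ x i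
    eMap-x_i= x i =
      L.⋁-least _ _ (λ j → L.⋁-least _ _ λ { refl → L.≤-refl }) ,
      L.≤-trans (L.⋁-ub (λ _ → x i) refl) (L.⋁-ub (λ j → x_i= (powF L) x i j j) i)

  eMap-hom : (L : Module V) →
             IsModuleHom (Pow T (Pow T (Module.raw L))) (Module.raw L) (eMap (Module.raw L))
  eMap-hom L = record
    { resp   = λ (xx≤yy , yy≤xx) → eMap-mono xx≤yy , eMap-mono yy≤xx
    ; pres-⋁ = λ g → ⋁-comm (λ i k → g k i i)
    ; pres-* = λ v xx → swap (*-⋁ʳ v (λ i → xx i i))
    }
    where
      open Counit (Module.raw L)
      open CLatProperties (Module.lat L) (Module.isCLat L)
      open IsModule (Module.isModule L)

  ε-hom : (L : Module V) →
          IsModuleHom (tensor (powF (Module.raw L))) (Module.raw L) (ε (Module.raw L))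
  ε-hom L = Fix-induced-hom HT (nJH P) nuc-ext nuc-mono
              (NucLemmas.nuc-idem HT.lat HT.isCLat (jJH P))
              (Module.raw L) (eMap (Module.raw L)) (eMap-hom L) eMap-nuc
    where
      P : RFSL V
      P = powF (Module.raw L)
      open Saturation P
      open Counit (Module.raw L)

  ε-unique : (L : RMod V) (g : RMod.Car (tensor (powF L)) → RMod.Car L) →
             IsModuleHom (tensor (powF L)) L g →
             ((xx : T → T → RMod.Car L) → RMod._≈_ L (g (q (powF L) xx)) (eMap L xx)) →
             ∀ m → RMod._≈_ L (g m) (ε L m)
  ε-unique L g g-hom g∘q≈e m = ≈-trans (IsModuleHom.resp g-hom (≈-q-proj₁ m)) (g∘q≈e (proj₁ m))
    where
      open Saturation (powF L)
      open CLatProperties (RMod.lat L) (RMod.isCLat L)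

  ε-natural : (L₁ L₂ : RMod V) (f : RMod.Car L₁ → RMod.Car L₂) → IsModuleHom L₁ L₂ f →
              ∀ m → RMod._≈_ L₂ (ε L₂ (tensorMap (powF L₁) (powF L₂) (powMap f) m)) (f (ε L₁ m))
  ε-natural L₁ L₂ f f-hom m =
    ≈-trans (eMap-nuc _) (swap (IsModuleHom.pres-⋁ f-hom (λ i → proj₁ m i i)))
    where
      open Counit L₂
      open CLatProperties (RMod.lat L₂) (RMod.isCLat L₂)

  ε-tensorMap-η : (H : RFSL V) (m : RMod.Car (tensor H)) →
                  RMod._≈_ (tensor H) (ε (tensor H) (tensorMap H (powF (tensor H)) (η H) m)) m
  ε-tensorMap-η H m =
    ≈-trans {ε (tensor H) (tensorMap H (powF (tensor H)) (η H) m)} {eMap (tensor H) ηm} {m}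
            (eMap-nuc ηm) (unfold-≤ , unfold-≥)
    where
      open Saturation H
      open Counit (tensor H)
      open CLatProperties (RMod.lat (tensor H)) (RMod.isCLat (tensor H))
      m-saturated : Saturated (proj₁ m)
      m-saturated = fixed⇒saturated (proj₂ m)
      ηm : T → T → RMod.Car (tensor H)
      ηm = powMap (η H) (proj₁ m)
      unfold-≤ : RMod._≤_ (tensor H) (eMap (tensor H) ηm) m
      unfold-≤ = nuc-least m-saturated (HT.⋁-least _ _ λ i →
                   nuc-least m-saturated (x_i=-least _ (RFSL.≤-refl H)))
      unfold-≥ : RMod._≤_ (tensor H) m (eMap (tensor H) ηm)
      unfold-≥ = HT.≤-trans (≤-⋁-x_i= (proj₁ m))
                   (HT.≤-trans (HT.⋁-mono λ i → nuc-ext _) (nuc-ext _))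

  ε^J∘η : (L : RMod V) (x : T → RMod.Car L) →
          RMod._≈_ (Pow T L) (powMap (ε L) (η (powF L) x)) x
  ε^J∘η L x = proj₁ ∘ ε-η , proj₂ ∘ ε-η
    where
      open Counit L
      open CLatProperties (RMod.lat L) (RMod.isCLat L)
      ε-η : ∀ i → RMod._≈_ L (ε L (η (powF L) x i)) (x i)
      ε-η i = ≈-trans (eMap-nuc _) (eMap-x_i= x i)

mainTheorem1 : ∀ {ℓ} (V : Quantale ℓ) (J : Frame V) →
  let open Tensor J in
  ((H : FSemilattice V) →
     IsLax (FSemilattice.toRFSL H)
           (powF (tensor (FSemilattice.toRFSL H)))
           (η (FSemilattice.toRFSL H)))
  × ((H₁ H₂ : FSemilattice V)
     (f : FSemilattice.Car H₁ → FSemilattice.Car H₂) →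
     IsLax (FSemilattice.toRFSL H₁) (FSemilattice.toRFSL H₂) f →
     ∀ x → RMod._≈_ (Pow (Frame.T J) (tensor (FSemilattice.toRFSL H₂)))
              (powMap (tensorMap (FSemilattice.toRFSL H₁) (FSemilattice.toRFSL H₂) f)
                      (η (FSemilattice.toRFSL H₁) x))
              (η (FSemilattice.toRFSL H₂) (f x)))
  × ((L : Module V) →
     IsModuleHom (tensor (powF (Module.raw L))) (Module.raw L) (ε (Module.raw L)))
  × ((L : Module V) (xx : Frame.T J → Frame.T J → Module.Car L) →
     Module._≈_ L (ε (Module.raw L) (q (powF (Module.raw L)) xx))
                  (eMap (Module.raw L) xx))
  × ((L : Module V)
     (g : RMod.Car (tensor (powF (Module.raw L))) → Module.Car L) →
     IsModuleHom (tensor (powF (Module.raw L))) (Module.raw L) g →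
     ((xx : Frame.T J → Frame.T J → Module.Car L) →
        Module._≈_ L (g (q (powF (Module.raw L)) xx)) (eMap (Module.raw L) xx)) →
     ∀ m → Module._≈_ L (g m) (ε (Module.raw L) m))
  × ((L₁ L₂ : Module V) (f : Module.Car L₁ → Module.Car L₂) →
     IsModuleHom (Module.raw L₁) (Module.raw L₂) f →
     ∀ m → Module._≈_ L₂
              (ε (Module.raw L₂)
                 (tensorMap (powF (Module.raw L₁)) (powF (Module.raw L₂)) (powMap f) m))
              (f (ε (Module.raw L₁) m)))
  × ((H : FSemilattice V) (m : RMod.Car (tensor (FSemilattice.toRFSL H))) →
     RMod._≈_ (tensor (FSemilattice.toRFSL H))
       (ε (tensor (FSemilattice.toRFSL H))
          (tensorMap (FSemilattice.toRFSL H)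
                     (powF (tensor (FSemilattice.toRFSL H)))
                     (η (FSemilattice.toRFSL H)) m))
       m)
  × ((L : Module V) (x : Frame.T J → Module.Car L) →
     RMod._≈_ (Pow (Frame.T J) (Module.raw L))
       (powMap (ε (Module.raw L)) (η (powF (Module.raw L)) x))
       x)
mainTheorem1 V J =
  Unit.η-isLax ,
  (λ H₁ H₂ → η-natural (FSemilattice.toRFSL H₁) (FSemilattice.toRFSL H₂)) ,
  ε-hom ,
  (λ L → Counit.eMap-nuc (Module.raw L)) ,
  (λ L → ε-unique (Module.raw L)) ,
  (λ L₁ L₂ → ε-natural (Module.raw L₁) (Module.raw L₂)) ,
  (λ H → ε-tensorMap-η (FSemilattice.toRFSL H)) ,
  (λ L → ε^J∘η (Module.raw L))
  where open Adjunction J
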